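{- The ray (one-way infinite path) has neither the Erdős–Pósa property nor the $\aleph_0$-Erdős–Pósa property.
   Context: A graph $G$ has the Erdős–Pósa property if there is $f:\mathbb N\to\mathbb N$ such that for every graph $\Gamma$ (possibly infinite) and every $k\in\mathbb N$, either $\Gamma$ contains $k$ pairwise disjoint subgraphs isomorphic to $G$, or there is $X\subseteq V(\Gamma)$ with $|X|\le f(k)$ such that $\Gamma-X$ contains no subgraph isomorphic to $G$. $G$ has the $\aleph_0$-Erdős–Pósa property if for every graph $\Gamma$, either $\Gamma$ contains infinitely many pairwise disjoint subgraphs isomorphic to $G$, or there is a finite $X\subseteq V(\Gamma)$ such that $\Gamma-X$ contains no subgraph isomorphic to $G$. -}

module Defs where

open import Data.Nat using (ℕ; suc; _≤_)
open import Data.Fin using (Fin)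
open import Data.List using (List; length)
open import Data.List.Membership.Propositional using (_∈_; _∉_)
open import Data.Product using (Σ; _×_; ∃)
open import Data.Sum using (_⊎_)
open import Relation.Nullary using (¬_)
open import Relation.Binary.PropositionalEquality using (_≡_; _≢_)
open import Function.Definitions using (Injective)

record Graph : Set₁ where
  field
    V     : Set
    E     : V → V → Set
    E-sym : ∀ {u v} → E u v → E v u
    E-irr : ∀ {u} → ¬ E u u
open Graph public

-- A subgraph of Γ isomorphic to G is exactly the image of an injective
-- edge-preserving map V(G) → V(Γ); we represent copies by such maps.
record Copy (G Γ : Graph) : Set where
  field
    map     : V G → V Γ
    inj     : Injective _≡_ _≡_ map
    preserv : ∀ {u v} → E G u v → E Γ (map u) (map v)
open Copy public

Disjoint : ∀ {G Γ} → Copy G Γ → Copy G Γ → Set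
Disjoint {G} φ ψ = ∀ (u v : V G) → map φ u ≢ map ψ v

kDisjointCopies : (G Γ : Graph) → ℕ → Set
kDisjointCopies G Γ k =
  Σ (Fin k → Copy G Γ) λ φ → ∀ i j → i ≢ j → Disjoint (φ i) (φ j)

InfDisjointCopies : (G Γ : Graph) → Set
InfDisjointCopies G Γ =
  Σ (ℕ → Copy G Γ) λ φ → ∀ i j → i ≢ j → Disjoint (φ i) (φ j)

Hits : (G Γ : Graph) → List (V Γ) → Set
Hits G Γ X = ¬ (Σ (Copy G Γ) λ φ → ∀ u → map φ u ∉ X)

ErdosPosa : Graph → Set₁
ErdosPosa G = Σ (ℕ → ℕ) λ f → ∀ (Γ : Graph) (k : ℕ) →
  kDisjointCopies G Γ k ⊎ Σ (List (V Γ)) λ X → length X ≤ f k × Hits G Γ X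

Aleph0ErdosPosa : Graph → Set₁
Aleph0ErdosPosa G = ∀ (Γ : Graph) →
  InfDisjointCopies G Γ ⊎ Σ (List (V Γ)) λ X → Hits G Γ X

RayE : ℕ → ℕ → Set
RayE m n = suc m ≡ n ⊎ suc n ≡ m

open import Data.Sum using (inj₁; inj₂)
open import Data.Nat.Properties using (1+n≢n)

Ray : Graph
Ray = record
  { V = ℕ
  ; E = RayE
  ; E-sym = λ { (inj₁ p) → inj₂ p ; (inj₂ p) → inj₁ p }
  ; E-irr = λ { (inj₁ p) → 1+n≢n p ; (inj₂ p) → 1+n≢n p }
  }

-- Every self-embedding of the ray is a shift n ↦ n + c: a step down would, by
-- injectivity, force every later step down too, an infinite descent in ℕ.
-- Hence the ray itself is a host graph in which any two rays meet, while no
-- finite vertex set meets every ray (shift past it), and it refutes both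
-- properties at once.
module Submission where

open import Defs
open import Data.Product using (_×_; _,_)
open import Relation.Nullary using (¬_)

open import Data.Nat using (ℕ; zero; suc; _+_)
open import Data.Nat.Properties
  using (+-suc; +-comm; +-cancelʳ-≡; m≢1+m+n; m≢1+n+m; 1+n≰n; m+n≤o⇒n≤o)
open import Data.Sum using (inj₁; inj₂)
open import Data.Empty using (⊥-elim)
open import Data.Fin using () renaming (zero to 0F; suc to sucF)
open import Data.List.Membership.Propositional using (_∈_)
open import Data.List.Extrema.Nat using (max; xs≤max)
open import Data.List.Relation.Unary.All using (lookup)
open import Relation.Binary.PropositionalEquality
  using (_≡_; refl; sym; trans; cong; module ≡-Reasoning)

module _ {G Γ : Graph} (meet : ∀ (φ ψ : Copy G Γ) → ¬ Disjoint φ ψ)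
                       (unhittable : ∀ X → ¬ Hits G Γ X) where

  ¬ErdosPosa-ofHost : ¬ ErdosPosa G
  ¬ErdosPosa-ofHost (f , ep) with ep Γ 2
  ... | inj₁ (φ , disjoint) = meet (φ 0F) (φ (sucF 0F)) (disjoint 0F (sucF 0F) λ ())
  ... | inj₂ (X , _ , hits) = unhittable X hits

  ¬Aleph0ErdosPosa-ofHost : ¬ Aleph0ErdosPosa G
  ¬Aleph0ErdosPosa-ofHost ep with ep Γ
  ... | inj₁ (φ , disjoint) = meet (φ 0) (φ 1) (disjoint 0 1 λ ())
  ... | inj₂ (X , hits) = unhittable X hits

module RayEmbedding (φ : Copy Ray Ray) where

  f : ℕ → ℕ
  f = map φ

  DescendsAt : ℕ → Set
  DescendsAt n = suc (f (suc n)) ≡ f n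

  descendsAt-suc : ∀ {n} → DescendsAt n → DescendsAt (suc n)
  descendsAt-suc {n} d with preserv φ {suc n} {suc (suc n)} (inj₁ refl)
  ... | inj₂ down = down
  ... | inj₁ up   = ⊥-elim (m≢1+n+m n (sym (inj φ (trans (sym up) d))))

  descendsAt-+ : ∀ {n} → DescendsAt n → ∀ k → DescendsAt (k + n)
  descendsAt-+ d zero    = d
  descendsAt-+ d (suc k) = descendsAt-suc (descendsAt-+ d k)

  descent-lowers : ∀ {n} → DescendsAt n → ∀ k → k + f (k + n) ≡ f n
  descent-lowers d zero    = refl
  descent-lowers {n} d (suc k) = begin
    suc k + f (suc (k + n))   ≡⟨ +-suc k _ ⟨
    k + suc (f (suc (k + n))) ≡⟨ cong (k +_) (descendsAt-+ d k) ⟩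
    k + f (k + n)             ≡⟨ descent-lowers d k ⟩
    f n                       ∎
    where open ≡-Reasoning

  ¬descendsAt : ∀ n → ¬ DescendsAt n
  ¬descendsAt n d = m≢1+m+n (f n) (sym (descent-lowers d (suc (f n))))

  f-suc : ∀ n → f (suc n) ≡ suc (f n)
  f-suc n with preserv φ {n} {suc n} (inj₁ refl)
  ... | inj₁ up   = sym up
  ... | inj₂ down = ⊥-elim (¬descendsAt n down)

  f≡+f0 : ∀ n → f n ≡ n + f 0
  f≡+f0 zero    = refl
  f≡+f0 (suc n) = trans (f-suc n) (cong suc (f≡+f0 n))

open RayEmbedding using (f≡+f0)

Ray-copies-meet : ∀ (φ ψ : Copy Ray Ray) → ¬ Disjoint φ ψ
Ray-copies-meet φ ψ disjoint = disjoint (map ψ 0) (map φ 0) (begin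
  map φ (map ψ 0)   ≡⟨ f≡+f0 φ (map ψ 0) ⟩
  map ψ 0 + map φ 0 ≡⟨ +-comm (map ψ 0) (map φ 0) ⟩
  map φ 0 + map ψ 0 ≡⟨ f≡+f0 ψ (map φ 0) ⟨
  map ψ (map φ 0)   ∎)
  where open ≡-Reasoning

shift : ℕ → Copy Ray Ray
shift s = record
  { map     = _+ s
  ; inj     = λ {m} {n} → +-cancelʳ-≡ s m n
  ; preserv = λ { (inj₁ p) → inj₁ (cong (_+ s) p) ; (inj₂ p) → inj₂ (cong (_+ s) p) }
  }

Ray-unhittable : ∀ X → ¬ Hits Ray Ray X
Ray-unhittable X hits = hits (shift (suc (max 0 X)) , avoids)
  where
  avoids : ∀ u → ¬ (u + suc (max 0 X) ∈ X)
  avoids u u∈X = 1+n≰n (m+n≤o⇒n≤o u (lookup (xs≤max 0 X) u∈X))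

proposition3p4 : ¬ ErdosPosa Ray × ¬ Aleph0ErdosPosa Ray
proposition3p4 = ¬ErdosPosa-ofHost Ray-copies-meet Ray-unhittable
               , ¬Aleph0ErdosPosa-ofHost Ray-copies-meet Ray-unhittable
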